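{- Let $T$ be a non-trivial min-cut tree of a simple graph $G$. Let $A,B$ be adjacent blocks of $T$, both of degree $2$ in $T$, where the neighbors of $A$ are $A'$ and $B$, and the neighbors of $B$ are $A$ and $B'$. If $|A|+|B|>2$, then $|A|+|B|\geq\delta(G)/2$.
   Context: For $X\subseteq V$, $d_G(X)$ is the number of edges with exactly one endpoint in $X$. A cut is a set $\emptyset\neq X\subsetneq V$; trivial if $|X|=1$ or $|V\setminus X|=1$. $\lambda(G)=\min_X d_G(X)$; a min-cut is a cut with $d_G(X)=\lambda(G)$; $X$ separates $a,b$ if exactly one lies in $X$. For a tree $T$ whose vertex set (blocks) is a partition of $V$ and an edge $AB$, $C_{AB}$ is the union of blocks in the component of $T-AB$ containing $A$. A non-trivial min-cut tree is such a tree with: (i) for every edge $AB$, $C_{AB}$ is a non-trivial min-cut of $G$; (ii) every two vertices separated by some non-trivial min-cut of $G$ are separated by $C_{AB}$ for some edge $AB$ of $T$. -}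

module Defs where

open import Data.Nat using (ℕ; zero; suc; _+_; _*_; _≤_; _<_; _⊓_)
open import Data.Fin using (Fin; zero; suc; _≟_)
open import Data.Bool using (Bool; true; false; not; _∧_; _∨_; if_then_else_)
open import Data.Product using (Σ; ∃; _×_; _,_)
open import Data.Sum using (_⊎_)
open import Relation.Binary.PropositionalEquality using (_≡_; _≢_)
open import Relation.Nullary using (¬_)
open import Relation.Nullary.Decidable using (⌊_⌋)
open import Function using (_∘_)

sumFin : ∀ {n} → (Fin n → ℕ) → ℕ
sumFin {zero} f = 0
sumFin {suc n} f = f zero + sumFin (f ∘ suc)

count : ∀ {n} → (Fin n → Bool) → ℕ
count f = sumFin (λ i → if f i then 1 else 0)

-- minimum of a function over Fin n (convention: 0 when n = 0)
minFin : ∀ {n} → (Fin n → ℕ) → ℕ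
minFin {zero} f = 0
minFin {suc zero} f = f zero
minFin {suc (suc n)} f = f zero ⊓ minFin (f ∘ suc)

record SimpleGraph (n : ℕ) : Set where
  field
    adj        : Fin n → Fin n → Bool
    adj-sym    : ∀ u v → adj u v ≡ adj v u
    adj-irrefl : ∀ u → adj u u ≡ false

VSet : ℕ → Set
VSet n = Fin n → Bool

size : ∀ {n} → VSet n → ℕ
size X = count X

compl : ∀ {n} → VSet n → VSet n
compl X = not ∘ X

module _ {n : ℕ} (G : SimpleGraph n) where
  open SimpleGraph G

  degree : Fin n → ℕ
  degree v = count (adj v)

  minDegree : ℕ
  minDegree = minFin degree

  -- d_G(X): number of edges with exactly one endpoint in X
  -- (each such edge uv is counted once, oriented with u ∈ X, v ∉ X)
  dG : VSet n → ℕ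
  dG X = sumFin (λ u → if X u then count (λ v → not (X v) ∧ adj u v) else 0)

IsCut : ∀ {n} → VSet n → Set
IsCut X = (∃ λ v → X v ≡ true) × (∃ λ v → X v ≡ false)

Trivial : ∀ {n} → VSet n → Set
Trivial X = size X ≡ 1 ⊎ size (compl X) ≡ 1

IsMinCut : ∀ {n} → SimpleGraph n → VSet n → Set
IsMinCut G X = IsCut X × (∀ Y → IsCut Y → dG G X ≤ dG G Y)

IsNonTrivialMinCut : ∀ {n} → SimpleGraph n → VSet n → Set
IsNonTrivialMinCut G X = IsMinCut G X × ¬ Trivial X

Separates : ∀ {n} → VSet n → Fin n → Fin n → Set
Separates X a b = X a ≢ X b

data Walk {k : ℕ} (R : Fin k → Fin k → Bool) : Fin k → Fin k → Set where
  here : ∀ a → Walk R a a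
  step : ∀ {a b c} → R a b ≡ true → Walk R b c → Walk R a c

-- a tree on node set Fin k: symmetric irreflexive adjacency, connected,
-- with exactly k - 1 edges (ordered adjacent pairs + 2 = 2k)
record Tree (k : ℕ) : Set where
  field
    tadj        : Fin k → Fin k → Bool
    tadj-sym    : ∀ a b → tadj a b ≡ tadj b a
    tadj-irrefl : ∀ a → tadj a a ≡ false
    connected   : ∀ a b → Walk tadj a b
    edgeCount   : sumFin (λ a → count (tadj a)) + 2 ≡ 2 * k

module _ {k : ℕ} (T : Tree k) where
  open Tree T

  removeEdge : Fin k → Fin k → Fin k → Fin k → Bool
  removeEdge A B x y =
    tadj x y ∧ not ((⌊ x ≟ A ⌋ ∧ ⌊ y ≟ B ⌋) ∨ (⌊ x ≟ B ⌋ ∧ ⌊ y ≟ A ⌋))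

  Degree2With : Fin k → Fin k → Fin k → Set
  Degree2With A x y =
    x ≢ y × tadj A x ≡ true × tadj A y ≡ true
      × (∀ z → tadj A z ≡ true → z ≡ x ⊎ z ≡ y)

  module _ {n : ℕ} (blk : Fin n → Fin k) where
    blockSize : Fin k → ℕ
    blockSize A = count (λ v → ⌊ blk v ≟ A ⌋)

    -- X is C_{AB}: the union of the blocks in the component of T - AB containing A
    IsSideCut : Fin k → Fin k → VSet n → Set
    IsSideCut A B X =
      ∀ v → (X v ≡ true → Walk (removeEdge A B) A (blk v))
          × (Walk (removeEdge A B) A (blk v) → X v ≡ true)

-- A non-trivial min-cut tree of G: a tree T on k nodes whose nodes are the
-- blocks of a partition of V (blk v is the block containing v; blocks nonempty)
record NonTrivialMinCutTree {n : ℕ} (G : SimpleGraph n) (k : ℕ) : Set where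
  field
    T        : Tree k
    blk      : Fin n → Fin k
    blk-surj : ∀ b → ∃ λ v → blk v ≡ b
    cond-i   : ∀ A B → Tree.tadj T A B ≡ true →
               ∃ λ X → IsSideCut T blk A B X × IsNonTrivialMinCut G X
    cond-ii  : ∀ a b → (∃ λ Y → IsNonTrivialMinCut G Y × Separates Y a b) →
               ∃ λ A → ∃ λ B → Tree.tadj T A B ≡ true ×
                 (∃ λ X → IsSideCut T blk A B X × Separates X a b)

module Submission where

-- Let S = A ∪ B, X = C_{AA'} and Y = C_{BB'}; X and Y are min-cuts by (i).
-- 1. Tree part.  Every edge PQ of T is a bridge: otherwise every block is
--    reachable from P in T - PQ, so C_{PQ} = V is not a cut.  As A and B have
--    degree 2, a walk from B in T - BB' ending outside {A, B} must leave {A, B}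
--    through A' (and symmetrically through B' from A in T - AA').  A block
--    outside {A, B} lying in both X and Y thus yields the walk
--    A B B' ~ A' in T - AA', contradicting that AA' is a bridge.  So S = X ∩ Y.
-- 2. Cut part.  d(X ∩ Y) ≤ d(X) + d(Y), and λ ≤ δ because a vertex of minimum
--    degree is itself a cut; hence d(S) ≤ 2δ.
-- 3. Counting part.  A vertex of S has at most |S| - 1 neighbours in S, so
--    (δ + 1)|S| ≤ |S|² + d(S) ≤ |S|² + 2δ, which for |S| > 2 gives δ ≤ 2|S|.

open import Defs
open import Data.Nat using (ℕ; zero; suc; _+_; _*_; _∸_; _≤_; _<_; _≤?_; z≤n; s≤s)
open import Data.Nat.Properties hiding (_≟_; suc-injective)
open import Data.Nat.Tactic.RingSolver using (solve-∀)
open import Data.Fin using (Fin; zero; suc; _≟_)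
open import Data.Fin.Properties using (suc-injective)
open import Data.Bool using (Bool; true; false; not; _∧_; _∨_; if_then_else_)
open import Data.Bool.Properties using (∧-comm; ∧-zeroʳ; ∨-zeroʳ)
open import Data.Product using (∃; _×_; _,_; proj₁; proj₂)
open import Data.Sum using (_⊎_; inj₁; inj₂; swap)
open import Data.Empty using (⊥; ⊥-elim)
open import Relation.Binary.PropositionalEquality
open import Relation.Nullary using (¬_; Dec; yes; no)
open import Relation.Nullary.Decidable using (⌊_⌋; isYes≗does; dec-true; dec-false; _×-dec_)
open import Function using (_∘_)
open import Algebra.Properties.CommutativeSemigroup +-commutativeSemigroup
  using (interchange)

true≢false : ∀ {b} → b ≡ true → b ≡ false → ⊥
true≢false refl ()

∧-true : ∀ {a b} → a ∧ b ≡ true → a ≡ true × b ≡ true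
∧-true {true} {true} _ = refl , refl

∧-intro : ∀ {a b} → a ≡ true → b ≡ true → a ∧ b ≡ true
∧-intro refl refl = refl

⌊⌋-true : ∀ {P : Set} (d : Dec P) → P → ⌊ d ⌋ ≡ true
⌊⌋-true d p = trans (isYes≗does d) (dec-true d p)

⌊⌋-false : ∀ {P : Set} (d : Dec P) → ¬ P → ⌊ d ⌋ ≡ false
⌊⌋-false d ¬p = trans (isYes≗does d) (dec-false d ¬p)

module _ {k : ℕ} {R : Fin k → Fin k → Bool} where

  _++w_ : ∀ {a b c} → Walk R a b → Walk R b c → Walk R a c
  here _ ++w w = w
  step r p ++w w = step r (p ++w w)

  reverse : (∀ x y → R x y ≡ R y x) → ∀ {a b} → Walk R a b → Walk R b a
  reverse sym-R (here a) = here a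
  reverse sym-R (step r w) = reverse sym-R w ++w step (trans (sym-R _ _) r) (here _)

mapWalk : ∀ {k} {R R' : Fin k → Fin k → Bool} → (∀ x y → R x y ≡ true → R' x y ≡ true) →
          ∀ {a b} → Walk R a b → Walk R' a b
mapWalk f (here a) = here a
mapWalk f (step r w) = step (f _ _ r) (mapWalk f w)

record Outside {k : ℕ} (O : Fin k → Bool) (A B : Fin k) : Set where
  field
    at-A : O A ≡ false
    at-B : O B ≡ false
    only : ∀ x → O x ≡ false → x ≡ A ⊎ x ≡ B

outside-swap : ∀ {k} {O : Fin k → Bool} {A B} → Outside O A B → Outside O B A
outside-swap out = record { at-A = at-B ; at-B = at-A ; only = λ x → swap ∘ only x }
  where open Outside out

outsidePair : ∀ {k} → Fin k → Fin k → Fin k → Bool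
outsidePair A B x = not (⌊ x ≟ A ⌋ ∨ ⌊ x ≟ B ⌋)

outsidePair-true : ∀ {k} {A B x : Fin k} → x ≢ A → x ≢ B → outsidePair A B x ≡ true
outsidePair-true {A = A} {B} {x} x≢A x≢B rewrite ⌊⌋-false (x ≟ A) x≢A | ⌊⌋-false (x ≟ B) x≢B = refl

outsidePair-outside : ∀ {k} (A B : Fin k) → Outside (outsidePair A B) A B
outsidePair-outside A B = record { at-A = at-A ; at-B = at-B ; only = only }
  where
    at-A : outsidePair A B A ≡ false
    at-A rewrite ⌊⌋-true (A ≟ A) refl = refl
    at-B : outsidePair A B B ≡ false
    at-B rewrite ⌊⌋-true (B ≟ B) refl | ∨-zeroʳ ⌊ B ≟ A ⌋ = refl
    only : ∀ x → outsidePair A B x ≡ false → x ≡ A ⊎ x ≡ B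
    only x h with x ≟ A | x ≟ B
    ... | yes x≡A | _ = inj₁ x≡A
    ... | no _ | yes x≡B = inj₂ x≡B
    ... | no _ | no _ = ⊥-elim (true≢false refl h)

module TreeEdges {k : ℕ} (T : Tree k) where
  open Tree T

  adjacent-distinct : ∀ {x y} → tadj x y ≡ true → x ≢ y
  adjacent-distinct {x} t refl = true≢false t (tadj-irrefl x)

  removeEdge-edge : ∀ P Q x y → removeEdge T P Q x y ≡ true → tadj x y ≡ true
  removeEdge-edge P Q x y r = proj₁ (∧-true r)

  removeEdge-keeps : ∀ P Q x y → tadj x y ≡ true →
                     ¬ (x ≡ P × y ≡ Q) → ¬ (x ≡ Q × y ≡ P) → removeEdge T P Q x y ≡ true
  removeEdge-keeps P Q x y t ¬PQ ¬QP rewrite t with x ≟ P | y ≟ Q | x ≟ Q | y ≟ P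
  ... | yes x≡P | yes y≡Q | _ | _ = ⊥-elim (¬PQ (x≡P , y≡Q))
  ... | _ | _ | yes x≡Q | yes y≡P = ⊥-elim (¬QP (x≡Q , y≡P))
  ... | no _ | _ | no _ | _ = refl
  ... | no _ | _ | yes _ | no _ = refl
  ... | yes _ | no _ | no _ | _ = refl
  ... | yes _ | no _ | yes _ | no _ = refl

  removeEdge-cut : ∀ P Q → removeEdge T P Q P Q ≡ false
  removeEdge-cut P Q rewrite ⌊⌋-true (P ≟ P) refl | ⌊⌋-true (Q ≟ Q) refl = ∧-zeroʳ (tadj P Q)

  removeEdge-cases : ∀ P Q x y → tadj x y ≡ true →
                     removeEdge T P Q x y ≡ true ⊎ (x ≡ P × y ≡ Q) ⊎ (x ≡ Q × y ≡ P)
  removeEdge-cases P Q x y t with (x ≟ P) ×-dec (y ≟ Q) | (x ≟ Q) ×-dec (y ≟ P)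
  ... | yes PQ | _ = inj₂ (inj₁ PQ)
  ... | no _ | yes QP = inj₂ (inj₂ QP)
  ... | no ¬PQ | no ¬QP = inj₁ (removeEdge-keeps P Q x y t ¬PQ ¬QP)

  -- If Q is still reachable from P in T - PQ, then so is every block reachable
  -- from P in T (a walk using PQ is rerouted through the walk from P to Q).
  reachAll : ∀ {P Q} → Walk (removeEdge T P Q) P Q →
             ∀ {x D} → Walk tadj x D → Walk (removeEdge T P Q) P x → Walk (removeEdge T P Q) P D
  reachAll P~Q (here _) P~x = P~x
  reachAll {P} {Q} P~Q (step {x} {y} t w) P~x with removeEdge-cases P Q x y t
  ... | inj₁ r = reachAll P~Q w (P~x ++w step r (here y))
  ... | inj₂ (inj₁ (refl , refl)) = reachAll P~Q w P~Q
  ... | inj₂ (inj₂ (refl , refl)) = reachAll P~Q w (here P)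

  inside : (Fin k → Bool) → Fin k → Fin k → Bool
  inside O x y = tadj x y ∧ (O x ∧ O y)

  inside-sym : ∀ O x y → inside O x y ≡ inside O y x
  inside-sym O x y = cong₂ _∧_ (tadj-sym x y) (∧-comm (O x) (O y))

  inside⊆removeEdge : ∀ {O P} Q → O P ≡ false → ∀ x y → inside O x y ≡ true → removeEdge T P Q x y ≡ true
  inside⊆removeEdge {O} {P} Q oP x y r =
    removeEdge-keeps P Q x y (proj₁ (∧-true r))
      (λ { (refl , _) → true≢false (proj₁ Ox×Oy) oP }) (λ { (_ , refl) → true≢false (proj₂ Ox×Oy) oP })
    where
      Ox×Oy : O x ≡ true × O y ≡ true
      Ox×Oy = ∧-true (proj₂ (∧-true {tadj x y} r))

  -- Read backwards, a walk in
  -- T - BB' ending outside {A, B} stays outside until it meets A or B; it can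
  -- only have come from A through A', since B has no usable edge leaving {A, B}.
  module ExitThrough {O : Fin k → Bool} {A B A' B' : Fin k} (out : Outside O A B)
                     (nbA : ∀ z → tadj A z ≡ true → z ≡ A' ⊎ z ≡ B)
                     (nbB : ∀ z → tadj B z ≡ true → z ≡ A ⊎ z ≡ B') where
    open Outside out

    fromA : ∀ {Q C} → tadj A Q ≡ true → O Q ≡ true → Walk (inside O) Q C → Walk (inside O) A' C
    fromA {Q} t oQ w with nbA Q t
    ... | inj₁ refl = w
    ... | inj₂ refl = ⊥-elim (true≢false oQ at-B)

    notFromB : ∀ {Q} → removeEdge T B B' B Q ≡ true → O Q ≡ true → ⊥
    notFromB {Q} r oQ with nbB Q (removeEdge-edge B B' B Q r)
    ... | inj₁ refl = true≢false oQ at-A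
    ... | inj₂ refl = true≢false r (removeEdge-cut B B')

    leave : ∀ {P Q C} → P ≡ A ⊎ P ≡ B → removeEdge T B B' P Q ≡ true →
            O Q ≡ true → Walk (inside O) Q C → Walk (inside O) A' C
    leave {P} {Q} (inj₁ refl) r oQ w = fromA (removeEdge-edge B B' P Q r) oQ w
    leave (inj₂ refl) r oQ w = ⊥-elim (notFromB r oQ)

    -- Induction along the walk, keeping its longest outside final segment.
    exitVia : ∀ {P C} → Walk (removeEdge T B B') P C → O C ≡ true →
              (O P ≡ true × Walk (inside O) P C) ⊎ Walk (inside O) A' C
    exitVia (here C) oC = inj₁ (oC , here C)
    exitVia (step {P} {Q} r w) oC with exitVia w oC | O P in oP
    ... | inj₂ A'~C | _ = inj₂ A'~C
    ... | inj₁ (oQ , Q~C) | true =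
      inj₁ (refl , step (∧-intro (removeEdge-edge B B' P Q r) (∧-intro oP oQ)) Q~C)
    ... | inj₁ (oQ , Q~C) | false = inj₂ (leave (only P oP) r oQ Q~C)

open TreeEdges

-- Condition (i) makes every edge PQ of T a bridge: otherwise C_{PQ} would be V.
bridge : ∀ {n k} {G : SimpleGraph n} (M : NonTrivialMinCutTree G k) →
         let open NonTrivialMinCutTree M in
         ∀ {P Q} → Tree.tadj T P Q ≡ true → ¬ Walk (removeEdge T P Q) P Q
bridge M {P} {Q} t P~Q with NonTrivialMinCutTree.cond-i M P Q t
... | X , side , (((_ , (v , Xv≡false)) , _) , _) =
  true≢false (proj₂ (side v) (reachAll T P~Q (connected P (blk v)) (here P))) Xv≡false
  where open NonTrivialMinCutTree M
        open Tree T

-- count f is definitionally the sum of ind (f i) over Fin n.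
ind : Bool → ℕ
ind b = if b then 1 else 0

sumFin-mono : ∀ {n} (f g : Fin n → ℕ) → (∀ i → f i ≤ g i) → sumFin f ≤ sumFin g
sumFin-mono {zero} f g f≤g = z≤n
sumFin-mono {suc n} f g f≤g = +-mono-≤ (f≤g zero) (sumFin-mono (f ∘ suc) (g ∘ suc) (f≤g ∘ suc))

sumFin-cong : ∀ {n} (f g : Fin n → ℕ) → (∀ i → f i ≡ g i) → sumFin f ≡ sumFin g
sumFin-cong {zero} f g f≡g = refl
sumFin-cong {suc n} f g f≡g = cong₂ _+_ (f≡g zero) (sumFin-cong (f ∘ suc) (g ∘ suc) (f≡g ∘ suc))

sumFin-+ : ∀ {n} (f g : Fin n → ℕ) → sumFin (λ i → f i + g i) ≡ sumFin f + sumFin g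
sumFin-+ {zero} f g = refl
sumFin-+ {suc n} f g =
  trans (cong (f zero + g zero +_) (sumFin-+ (f ∘ suc) (g ∘ suc)))
        (interchange (f zero) (g zero) (sumFin (f ∘ suc)) (sumFin (g ∘ suc)))

sumFin-scale : ∀ {n} (c : ℕ) (f : Fin n → ℕ) → sumFin (λ i → c * f i) ≡ c * sumFin f
sumFin-scale {zero} c f = sym (*-zeroʳ c)
sumFin-scale {suc n} c f =
  trans (cong (c * f zero +_) (sumFin-scale c (f ∘ suc))) (sym (*-distribˡ-+ c (f zero) _))

sumFin-single : ∀ {n} (g : Fin n → ℕ) (w : Fin n) → (∀ u → u ≢ w → g u ≡ 0) → sumFin g ≡ g w
sumFin-single {suc n} g zero g≡0 =
  trans (cong (g zero +_) (trans (sumFin-cong (g ∘ suc) (λ _ → 0) (λ i → g≡0 (suc i) (λ ())))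
                                 (sumFin-zero n)))
        (+-identityʳ (g zero))
  where
    sumFin-zero : ∀ m → sumFin {m} (λ _ → 0) ≡ 0
    sumFin-zero zero = refl
    sumFin-zero (suc m) = sumFin-zero m
sumFin-single {suc n} g (suc w) g≡0 =
  cong₂ _+_ (g≡0 zero (λ ())) (sumFin-single (g ∘ suc) w (λ u u≢w → g≡0 (suc u) (u≢w ∘ suc-injective)))

count≤ : ∀ {n} (f : Fin n → Bool) → count f ≤ n
count≤ {zero} f = z≤n
count≤ {suc n} f with f zero
... | true = s≤s (count≤ (f ∘ suc))
... | false = m≤n⇒m≤1+n (count≤ (f ∘ suc))

count-singleton : ∀ {n} (w : Fin n) → count (λ v → ⌊ v ≟ w ⌋) ≡ 1
count-singleton w =
  trans (sumFin-single (λ v → ind ⌊ v ≟ w ⌋) w (λ v v≢w → cong ind (⌊⌋-false (v ≟ w) v≢w)))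
        (cong ind (⌊⌋-true (w ≟ w) refl))

blockSize-pair : ∀ {n k} (T : Tree k) (blk : Fin n → Fin k) {A B : Fin k} → B ≢ A →
                 blockSize T blk A + blockSize T blk B ≡ count (λ u → ⌊ blk u ≟ A ⌋ ∨ ⌊ blk u ≟ B ⌋)
blockSize-pair T blk {A} {B} B≢A =
  trans (sym (sumFin-+ (λ u → ind ⌊ blk u ≟ A ⌋) (λ u → ind ⌊ blk u ≟ B ⌋)))
        (sumFin-cong _ _ disjoint)
  where
    disjoint : ∀ u → ind ⌊ blk u ≟ A ⌋ + ind ⌊ blk u ≟ B ⌋ ≡ ind (⌊ blk u ≟ A ⌋ ∨ ⌊ blk u ≟ B ⌋)
    disjoint u with blk u ≟ A | blk u ≟ B
    ... | yes e | yes e' = ⊥-elim (B≢A (trans (sym e') e))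
    ... | yes _ | no _ = refl
    ... | no _ | yes _ = refl
    ... | no _ | no _ = refl

minFin-le : ∀ {n} (f : Fin n → ℕ) i → minFin f ≤ f i
minFin-le {suc zero} f zero = ≤-refl
minFin-le {suc (suc n)} f zero = m⊓n≤m _ _
minFin-le {suc (suc n)} f (suc i) = ≤-trans (m⊓n≤n _ _) (minFin-le (f ∘ suc) i)

minFin-attained : ∀ {n} (f : Fin (suc n) → ℕ) → ∃ λ w → minFin f ≡ f w
minFin-attained {zero} f = zero , refl
minFin-attained {suc n} f with minFin-attained (f ∘ suc) | ⊓-sel (f zero) (minFin (f ∘ suc))
... | _ | inj₁ e = zero , e
... | w , e' | inj₂ e = suc w , trans e e'

quadratic-bound : ∀ s m → 2 < s → (m + 1) * s ≤ s * s + 2 * m → m ≤ 2 * s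
quadratic-bound (suc (suc zero)) m (s≤s (s≤s ())) h
quadratic-bound (suc (suc (suc t))) m _ h with m ≤? 2 * (3 + t)
... | yes m≤2s = m≤2s
... | no m≰2s = ⊥-elim (too-large (m ∸ suc (2 * (3 + t))) (sym (m+[n∸m]≡n (≰⇒> m≰2s))))
  where
    -- writing s = 3 + t and m = 2s + 1 + r, the left side exceeds the right side
    excess : ∀ t r → (suc (2 * (3 + t)) + r + 1) * (3 + t)
                   ≡ suc ((3 + t) * (3 + t) + 2 * (suc (2 * (3 + t)) + r) + (t * t + 4 * t + r + r * t))
    excess = solve-∀
    too-large : ∀ r → m ≡ suc (2 * (3 + t)) + r → ⊥
    too-large r refl = <-irrefl refl (<-≤-trans rhs<lhs h)
      where
        rhs : ℕ
        rhs = (3 + t) * (3 + t) + 2 * (suc (2 * (3 + t)) + r)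
        rhs<lhs : rhs < (suc (2 * (3 + t)) + r + 1) * (3 + t)
        rhs<lhs = subst (rhs <_) (sym (excess t r)) (s≤s (m≤m+n rhs _))

module _ {n : ℕ} (G : SimpleGraph n) where
  open SimpleGraph G

  crossing : VSet n → Fin n → ℕ
  crossing S u = if S u then count (λ v → not (S v) ∧ adj u v) else 0

  -- d(X ∩ Y) ≤ d(X) + d(Y): an edge leaving X ∩ Y leaves X or leaves Y.
  dG-intersection : ∀ {S X Y : VSet n} → (∀ u → S u ≡ X u ∧ Y u) → dG G S ≤ dG G X + dG G Y
  dG-intersection {S} {X} {Y} S≡X∧Y =
    ≤-trans (sumFin-mono (crossing S) _ crossing-sub) (≤-reflexive (sumFin-+ (crossing X) (crossing Y)))
    where
      leaves : ∀ x y a → ind (not (x ∧ y) ∧ a) ≤ ind (not x ∧ a) + ind (not y ∧ a)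
      leaves true true a = z≤n
      leaves true false a = ≤-refl
      leaves false y a = m≤m+n (ind a) _
      crossing-sub : ∀ u → crossing S u ≤ crossing X u + crossing Y u
      crossing-sub u rewrite S≡X∧Y u with X u | Y u
      ... | false | _ = z≤n
      ... | true | false = z≤n
      ... | true | true =
        ≤-trans (sumFin-mono _ _ (λ v → subst (λ s → ind (not s ∧ adj u v) ≤ _) (sym (S≡X∧Y v))
                                             (leaves (X v) (Y v) (adj u v))))
                (≤-reflexive (sumFin-+ (λ v → ind (not (X v) ∧ adj u v)) (λ v → ind (not (Y v) ∧ adj u v))))

  singleton : Fin n → VSet n
  singleton w v = ⌊ v ≟ w ⌋

  dG-singleton : ∀ w → dG G (singleton w) ≤ degree G w
  dG-singleton w =
    begin
      dG G (singleton w)                                ≡⟨ sumFin-single (crossing (singleton w)) w off-w ⟩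
      crossing (singleton w) w                          ≡⟨ cong (λ b → if b then leaving else 0) (⌊⌋-true (w ≟ w) refl) ⟩
      leaving                                           ≤⟨ sumFin-mono _ _ (λ v → ind-∧ (singleton w v) (adj w v)) ⟩
      degree G w                                        ∎
    where
      open ≤-Reasoning
      leaving : ℕ
      leaving = count (λ v → not (singleton w v) ∧ adj w v)
      off-w : ∀ u → u ≢ w → crossing (singleton w) u ≡ 0
      off-w u u≢w = cong (λ b → if b then count (λ v → not (singleton w v) ∧ adj u v) else 0)
                         (⌊⌋-false (u ≟ w) u≢w)
      ind-∧ : ∀ b a → ind (not b ∧ a) ≤ ind a
      ind-∧ true a = z≤n
      ind-∧ false a = ≤-refl

  neighbours-inside : ∀ S u → S u ≡ true → count (λ v → S v ∧ adj u v) + 1 ≤ count S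
  neighbours-inside S u Su =
    subst (_≤ count S)
      (trans (sumFin-+ (λ v → ind (S v ∧ adj u v)) (λ v → ind ⌊ v ≟ u ⌋))
             (cong (count (λ v → S v ∧ adj u v) +_) (count-singleton u)))
      (sumFin-mono _ _ (λ v → pointwise v (v ≟ u)))
    where
      pointwise : ∀ v → (d : Dec (v ≡ u)) → ind (S v ∧ adj u v) + ind ⌊ d ⌋ ≤ ind (S v)
      pointwise v (yes refl) rewrite Su | adj-irrefl u = ≤-refl
      pointwise v (no _) rewrite +-identityʳ (ind (S v ∧ adj u v)) = ∧-bound (S v) (adj u v)
        where
          ∧-bound : ∀ a b → ind (a ∧ b) ≤ ind a
          ∧-bound true true = ≤-refl
          ∧-bound true false = z≤n
          ∧-bound false b = z≤n

  degree-inside : ∀ S u → S u ≡ true → degree G u + 1 ≤ count S + count (λ v → not (S v) ∧ adj u v)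
  degree-inside S u Su =
    begin
      degree G u + 1                          ≡⟨ cong (_+ 1) split ⟩
      inS + outS + 1                          ≡⟨ +-assoc inS outS 1 ⟩
      inS + (outS + 1)                        ≡⟨ cong (inS +_) (+-comm outS 1) ⟩
      inS + (1 + outS)                        ≡⟨ sym (+-assoc inS 1 outS) ⟩
      inS + 1 + outS                          ≤⟨ +-monoˡ-≤ outS (neighbours-inside S u Su) ⟩
      count S + outS                          ∎
    where
      open ≤-Reasoning
      inS outS : ℕ
      inS = count (λ v → S v ∧ adj u v)
      outS = count (λ v → not (S v) ∧ adj u v)
      by-side : ∀ s a → ind a ≡ ind (s ∧ a) + ind (not s ∧ a)
      by-side true a = sym (+-identityʳ (ind a))
      by-side false a = refl
      split : degree G u ≡ inS + outS
      split = trans (sumFin-cong _ _ (λ v → by-side (S v) (adj u v)))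
                    (sumFin-+ (λ v → ind (S v ∧ adj u v)) (λ v → ind (not (S v) ∧ adj u v)))

  degreeSum-bound : ∀ S m → (∀ u → m ≤ degree G u) → (m + 1) * count S ≤ count S * count S + dG G S
  degreeSum-bound S m m≤deg =
    begin
      (m + 1) * count S                                 ≡⟨ sym (sumFin-scale (m + 1) (ind ∘ S)) ⟩
      sumFin (λ u → (m + 1) * ind (S u))                ≤⟨ sumFin-mono _ _ pointwise ⟩
      sumFin (λ u → count S * ind (S u) + crossing S u) ≡⟨ sumFin-+ (λ u → count S * ind (S u)) (crossing S) ⟩
      sumFin (λ u → count S * ind (S u)) + dG G S       ≡⟨ cong (_+ dG G S) (sumFin-scale (count S) (ind ∘ S)) ⟩
      count S * count S + dG G S                        ∎
    where
      open ≤-Reasoning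
      pointwise : ∀ u → (m + 1) * ind (S u) ≤ count S * ind (S u) + crossing S u
      pointwise u with S u in Su
      ... | false = ≤-reflexive (trans (*-zeroʳ (m + 1)) (sym (trans (+-identityʳ _) (*-zeroʳ (count S)))))
      ... | true rewrite *-identityʳ (m + 1) | *-identityʳ (count S) =
        ≤-trans (+-monoˡ-≤ 1 (m≤deg u)) (degree-inside S u Su)

-- λ(G) ≤ δ(G): a vertex of minimum degree is a cut of size at most δ.
minCut≤minDegree : ∀ {n} (G : SimpleGraph n) {X : VSet n} → IsMinCut G X → 1 < n → dG G X ≤ minDegree G
minCut≤minDegree {suc zero} G _ (s≤s ())
minCut≤minDegree {suc (suc n)} G {X} (_ , minimal) _ with minFin-attained (degree G)
... | w , δ≡deg-w =
  ≤-trans (minimal (singleton G w) singleton-cut) (≤-trans (dG-singleton G w) (≤-reflexive (sym δ≡deg-w)))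
  where
    other : ∀ (x : Fin (suc (suc n))) → ∃ λ y → y ≢ x
    other zero = suc zero , λ ()
    other (suc _) = zero , λ ()
    singleton-cut : IsCut (singleton G w)
    singleton-cut = (w , ⌊⌋-true (w ≟ w) refl) , (proj₁ (other w) , ⌊⌋-false (proj₁ (other w) ≟ w) (proj₂ (other w)))

module DegreeTwoPair {n k : ℕ} {G : SimpleGraph n} (M : NonTrivialMinCutTree G k) {A B A' B' : Fin k}
                     (dA : Degree2With (NonTrivialMinCutTree.T M) A A' B)
                     (dB : Degree2With (NonTrivialMinCutTree.T M) B A B') where
  open NonTrivialMinCutTree M
  open Tree T

  tAA' : tadj A A' ≡ true
  tAA' = proj₁ (proj₂ dA)

  tAB : tadj A B ≡ true
  tAB = proj₁ (proj₂ (proj₂ dA))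

  tBA : tadj B A ≡ true
  tBA = proj₁ (proj₂ dB)

  tBB' : tadj B B' ≡ true
  tBB' = proj₁ (proj₂ (proj₂ dB))

  nbA : ∀ z → tadj A z ≡ true → z ≡ A' ⊎ z ≡ B
  nbA = proj₂ (proj₂ (proj₂ dA))

  nbB : ∀ z → tadj B z ≡ true → z ≡ A ⊎ z ≡ B'
  nbB = proj₂ (proj₂ (proj₂ dB))

  B≢A : B ≢ A
  B≢A = adjacent-distinct T tBA

  B≢A' : B ≢ A'
  B≢A' = proj₁ dA ∘ sym

  A~B : Walk (removeEdge T A A') A B
  A~B = step (removeEdge-keeps T A A' A B tAB (B≢A' ∘ proj₂) (adjacent-distinct T tAA' ∘ proj₁)) (here B)

  A~B' : Walk (removeEdge T A A') A B'
  A~B' = A~B ++w step (removeEdge-keeps T A A' B B' tBB' (B≢A ∘ proj₁) (B≢A' ∘ proj₁)) (here B')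

  B~A : Walk (removeEdge T B B') B A
  B~A = step (removeEdge-keeps T B B' B A tBA (proj₁ dB ∘ proj₂) (adjacent-distinct T tBB' ∘ proj₁)) (here A)

  O : Fin k → Bool
  O = outsidePair A B

  out : Outside O A B
  out = outsidePair-outside A B

  -- No block outside {A, B} lies in both C_{AA'} and C_{BB'}: the two exit walks
  -- would close the walk A B B' ~ C ~ A' in T - AA', but AA' is a bridge.
  noCommonOutside : ∀ {C} → C ≢ A → C ≢ B →
                    Walk (removeEdge T A A') A C → Walk (removeEdge T B B') B C → ⊥
  noCommonOutside C≢A C≢B A~C B~C
    with ExitThrough.exitVia T out nbA nbB B~C (outsidePair-true C≢A C≢B)
       | ExitThrough.exitVia T (outside-swap out) (λ z → swap ∘ nbB z) (λ z → swap ∘ nbA z) A~C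
                               (outsidePair-true C≢A C≢B)
  ... | inj₁ (B-out , _) | _ = true≢false B-out (Outside.at-B out)
  ... | _ | inj₁ (A-out , _) = true≢false A-out (Outside.at-A out)
  ... | inj₂ A'~C | inj₂ B'~C =
    bridge M tAA' (A~B' ++w mapWalk (inside⊆removeEdge T {O} A' (Outside.at-A out))
                                    (B'~C ++w reverse (inside-sym T O) A'~C))

  pairSet : VSet n
  pairSet u = ⌊ blk u ≟ A ⌋ ∨ ⌊ blk u ≟ B ⌋

  inSide : ∀ {P Q Z u C} → IsSideCut T blk P Q Z → blk u ≡ C → Walk (removeEdge T P Q) P C → Z u ≡ true
  inSide {u = u} side refl w = proj₂ (side u) w

  pair-is-intersection : ∀ {X Y} → IsSideCut T blk A A' X → IsSideCut T blk B B' Y →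
                         ∀ u → pairSet u ≡ X u ∧ Y u
  pair-is-intersection {X} {Y} sideX sideY u with blk u ≟ A | blk u ≟ B
  ... | yes e | _ = sym (∧-intro (inSide sideX e (here A)) (inSide sideY e B~A))
  ... | no _ | yes e = sym (∧-intro (inSide sideX e A~B) (inSide sideY e (here B)))
  ... | no u∉A | no u∉B = sym not-both
    where
      not-both : X u ∧ Y u ≡ false
      not-both with X u in Xu | Y u in Yu
      ... | false | _ = refl
      ... | true | false = refl
      ... | true | true = ⊥-elim (noCommonOutside u∉A u∉B (proj₁ (sideX u) Xu) (proj₁ (sideY u) Yu))

lemma5 : ∀ {n k : ℕ} (G : SimpleGraph n) (M : NonTrivialMinCutTree G k)
           (A B A' B' : Fin k) →
           Tree.tadj (NonTrivialMinCutTree.T M) A B ≡ true →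
           Degree2With (NonTrivialMinCutTree.T M) A A' B →
           Degree2With (NonTrivialMinCutTree.T M) B A B' →
           2 < blockSize (NonTrivialMinCutTree.T M) (NonTrivialMinCutTree.blk M) A
               + blockSize (NonTrivialMinCutTree.T M) (NonTrivialMinCutTree.blk M) B →
           minDegree G ≤ 2 * (blockSize (NonTrivialMinCutTree.T M) (NonTrivialMinCutTree.blk M) A
               + blockSize (NonTrivialMinCutTree.T M) (NonTrivialMinCutTree.blk M) B)
lemma5 {n} G M A B A' B' _ dA dB 2<|A|+|B|
  with NonTrivialMinCutTree.cond-i M A A' (DegreeTwoPair.tAA' M dA dB)
     | NonTrivialMinCutTree.cond-i M B B' (DegreeTwoPair.tBB' M dA dB)
... | X , sideX , (X-min , _) | Y , sideY , (Y-min , _) =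
  subst (λ s → minDegree G ≤ 2 * s) (sym |A|+|B|≡|S|)
    (quadratic-bound (count S) (minDegree G) 2<|S|
      (≤-trans (degreeSum-bound G S (minDegree G) (minFin-le (degree G))) (+-monoʳ-≤ (count S * count S) dS≤2δ)))
  where
    open NonTrivialMinCutTree M using (T; blk)
    open DegreeTwoPair M dA dB using (pairSet; pair-is-intersection; B≢A)
    S : VSet n
    S = pairSet
    |A|+|B|≡|S| : blockSize T blk A + blockSize T blk B ≡ count S
    |A|+|B|≡|S| = blockSize-pair T blk B≢A
    2<|S| : 2 < count S
    2<|S| = subst (2 <_) |A|+|B|≡|S| 2<|A|+|B|
    1<n : 1 < n
    1<n = ≤-trans (<⇒≤ 2<|S|) (count≤ S)
    dS≤2δ : dG G S ≤ 2 * minDegree G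
    dS≤2δ = ≤-trans (dG-intersection G (pair-is-intersection sideX sideY))
              (≤-trans (+-mono-≤ (minCut≤minDegree G X-min 1<n) (minCut≤minDegree G Y-min 1<n))
                       (≤-reflexive (cong (minDegree G +_) (sym (+-identityʳ (minDegree G))))))
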